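{- Let $G$ be a graph and let $m\ge2$ be an integer such that there exists a Hadamard matrix of order $m-1$ and $G$ admits an $m$-cycle double cover. Then $\Phi^1_{m-1}(G)=2$.
   Context: A Hadamard matrix of order $n$ is an $n\times n$ matrix $H$ with entries in $\{+1,-1\}$ such that $HH^T=nI_n$. A cycle in a graph is a (possibly empty) subgraph in which every vertex has even degree; an $m$-cycle double cover of $G$ is a collection of $m$ cycles such that each edge of $G$ lies in exactly two of them. For an integer $d\ge1$, an $\mathbb{R}^d$-flow on $G=(V,E)$ consists of an orientation of the edges and a map $\varphi\colon E\to\mathbb{R}^d$ satisfying flow conservation at every vertex; for real $r\ge2$, an $(r,d)$-MNZF is such a flow with $1\le\|\varphi(e)\|_1\le r-1$ for every edge, where $\|x\|_1=\sum_i|x_i|$; and $\Phi_d^1(G)$ is the infimum of all $r\ge2$ for which $G$ has an $(r,d)$-MNZF.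
   Formalization: The bound r ranges over the rationals rather than the reals, and the flows take values in ℚ^(m−1) instead of ℝ^(m−1). -}

module Defs where

open import Data.Nat as ℕ using (ℕ; zero; suc; _∸_)
open import Data.Nat.Divisibility using (_∣_)
open import Data.Fin using (Fin; zero; suc; _≟_)
open import Data.Bool using (Bool; true; false; if_then_else_)
open import Data.Integer as ℤ using (ℤ; +_)
open import Data.Rational as ℚ using (ℚ; 0ℚ; 1ℚ)
open import Data.Product using (Σ; _×_; _,_; ∃)
open import Data.Sum using (_⊎_)
open import Relation.Binary.PropositionalEquality using (_≡_)
open import Relation.Nullary.Decidable using (⌊_⌋)

sumFin : {A : Set} → A → (A → A → A) → (n : ℕ) → (Fin n → A) → A
sumFin z _⊕_ zero    f = z
sumFin z _⊕_ (suc n) f = f zero ⊕ sumFin z _⊕_ n (λ i → f (suc i))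

Σℕ : (n : ℕ) → (Fin n → ℕ) → ℕ
Σℕ = sumFin 0 ℕ._+_

Σℤ : (n : ℕ) → (Fin n → ℤ) → ℤ
Σℤ = sumFin (+ 0) ℤ._+_

Σℚ : (n : ℕ) → (Fin n → ℚ) → ℚ
Σℚ = sumFin 0ℚ ℚ._+_

IsHadamard : (n : ℕ) → (Fin n → Fin n → ℤ) → Set
IsHadamard n H =
  (∀ i j → H i j ≡ ℤ.+ 1 ⊎ H i j ≡ ℤ.- (ℤ.+ 1)) ×
  (∀ i j → Σℤ n (λ k → H i k ℤ.* H j k)
             ≡ (if ⌊ i ≟ j ⌋ then + n else + 0))

HadamardExists : ℕ → Set
HadamardExists n = Σ (Fin n → Fin n → ℤ) (IsHadamard n)

-- Finite (multi)graphs: vertices Fin n, edges Fin k, each edge has two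
-- endpoints (loops and parallel edges allowed).

record Graph : Set where
  field
    nV : ℕ
    nE : ℕ
    end₁ : Fin nE → Fin nV
    end₂ : Fin nE → Fin nV
open Graph public

indicator : Bool → ℕ
indicator true  = 1
indicator false = 0

EdgeSet : Graph → Set
EdgeSet G = Fin (nE G) → Bool

-- degree of v in the edge set S (a loop at v counts 2)
degree : (G : Graph) → EdgeSet G → Fin (nV G) → ℕ
degree G S v = Σℕ (nE G) (λ e →
  if S e then indicator ⌊ end₁ G e ≟ v ⌋ ℕ.+ indicator ⌊ end₂ G e ≟ v ⌋
         else 0)

-- a cycle: every vertex has even degree (possibly empty)
IsCycle : (G : Graph) → EdgeSet G → Set
IsCycle G S = ∀ v → 2 ∣ degree G S v

HasCDC : (m : ℕ) → Graph → Set
HasCDC m G = Σ (Fin m → EdgeSet G) λ C →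
  (∀ i → IsCycle G (C i)) ×
  (∀ e → Σℕ m (λ i → indicator (C i e)) ≡ 2)

Vecℚ : ℕ → Set
Vecℚ d = Fin d → ℚ

norm₁ : (d : ℕ) → Vecℚ d → ℚ
norm₁ d x = Σℚ d (λ i → ℚ.∣ x i ∣)

Orientation : Graph → Set
Orientation G = Fin (nE G) → Bool

tail head : (G : Graph) → Orientation G → Fin (nE G) → Fin (nV G)
tail G o e = if o e then end₁ G e else end₂ G e
head G o e = if o e then end₂ G e else end₁ G e

IsFlow : (G : Graph) (d : ℕ) → Orientation G → (Fin (nE G) → Vecℚ d) → Set
IsFlow G d o φ = ∀ v (i : Fin d) →
  Σℚ (nE G) (λ e → if ⌊ head G o e ≟ v ⌋ then φ e i else 0ℚ)
    ≡ Σℚ (nE G) (λ e → if ⌊ tail G o e ≟ v ⌋ then φ e i else 0ℚ)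

HasMNZF : (G : Graph) (r : ℚ) (d : ℕ) → Set
HasMNZF G r d = Σ (Orientation G) λ o → Σ (Fin (nE G) → Vecℚ d) λ φ →
  IsFlow G d o φ ×
  (∀ e → 1ℚ ℚ.≤ norm₁ d (φ e) × norm₁ d (φ e) ℚ.≤ r ℚ.- 1ℚ)

-- Φ¹_d(G) = 2 : since Φ ≥ 2 by definition and the set of admissible r is
-- upward closed, this says exactly that an (r,d)-MNZF exists for every r > 2.
Phi1IsTwo : Graph → ℕ → Set
Phi1IsTwo G d = ∀ (r : ℚ) → ℚ.1ℚ ℚ.+ 1ℚ ℚ.< r → HasMNZF G r d

{-# OPTIONS --safe #-}
-- Every even subgraph has an Eulerian orientation (contract a path u–w–y into an edge
-- u–y and recurse), so each cycle Cᵢ of the double cover carries a ±1-valued integer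
-- circulation xᵢ.  With H a Hadamard matrix of order d = m − 1, the map
-- φ(e) = (1/d) Σᵢ₌₁..d xᵢ(e) Hᵢ is a ℚ^d-flow.  An edge lies either in C₀ and exactly one
-- other cycle, so that φ(e) is ±1/d times a row of H, or in two cycles among C₁, …, C_d,
-- so that φ(e) = (±Hⱼ ± Hⱼ′)/d; since |a + b| = 1 + ab for a, b = ±1 and distinct rows of
-- H are orthogonal, ‖φ(e)‖₁ = 1 in both cases.
module Submission where

open import Defs
open import Algebra.Properties.CommutativeSemigroup as CommutativeSemigroupProperties
  using ()
open import Data.Bool using (Bool; true; false; if_then_else_)
open import Data.Bool.Properties using (if-eta)
open import Data.Fin using (Fin; zero; suc; _≟_)
open import Data.Fin.Properties using (suc-injective)
open import Data.Integer as ℤ using (ℤ; +_; -_; _+_; _-_; _*_; ∣_∣)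
import Data.Integer.Properties as ℤP
open import Data.List using (List; []; _∷_; _++_; length; tabulate)
open import Data.List.Properties using (length-++-sucʳ)
open import Data.List.Relation.Binary.Pointwise using (Pointwise; []; _∷_; ++⁺)
open import Data.Nat as ℕ using (ℕ; zero; suc; _≤_; _∸_; s≤s; z≤n)
open import Data.Nat.Divisibility using (_∣_; divides; ∣m+n∣m⇒∣n; ∣1⇒≡1)
import Data.Nat.Properties as ℕP
open import Data.Nat.Tactic.RingSolver using (solve-∀)
open import Data.Product using (∃; ∃₂; _×_; _,_; proj₁; proj₂)
open import Data.Rational as ℚ using (ℚ; 0ℚ; 1ℚ)
open import Data.Rational.Literals using (fromℤ)
import Data.Rational.Properties as ℚP
open import Data.Rational.Unnormalised using (*≡*)
import Data.Rational.Unnormalised.Properties as ℚᵘP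
open import Data.Sum using (_⊎_; inj₁; inj₂)
open import Function using (_∘_)
open import Relation.Binary.Definitions using (DecidableEquality)
open import Relation.Binary.PropositionalEquality
  using (_≡_; _≢_; refl; sym; trans; cong; cong₂; subst; module ≡-Reasoning)
open import Relation.Nullary using (yes; no; contradiction)
open import Relation.Nullary.Decidable using (⌊_⌋)

open ≡-Reasoning

open CommutativeSemigroupProperties ℤP.+-commutativeSemigroup
  using () renaming (interchange to +-interchange; x∙yz≈y∙xz to +-left-commute)
open CommutativeSemigroupProperties ℤP.*-commutativeSemigroup
  using () renaming (interchange to *-interchange)
open CommutativeSemigroupProperties ℕP.+-commutativeSemigroup
  using () renaming (x∙yz≈y∙xz to ℕ-+-left-commute)

sumFin-cong : {A : Set} {z : A} {_⊕_ : A → A → A} (n : ℕ) {f g : Fin n → A} →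
              (∀ i → f i ≡ g i) → sumFin z _⊕_ n f ≡ sumFin z _⊕_ n g
sumFin-cong zero                f≗g = refl
sumFin-cong {_⊕_ = _⊕_} (suc n) f≗g = cong₂ _⊕_ (f≗g zero) (sumFin-cong n (f≗g ∘ suc))

sumFin-homo : {A B : Set} {z : A} {_⊕_ : A → A → A} {z′ : B} {_⊕′_ : B → B → B}
              (h : A → B) → h z ≡ z′ → (∀ a b → h (a ⊕ b) ≡ h a ⊕′ h b) →
              ∀ n (f : Fin n → A) → h (sumFin z _⊕_ n f) ≡ sumFin z′ _⊕′_ n (h ∘ f)
sumFin-homo h h-z h-⊕ zero    f = h-z
sumFin-homo {_⊕′_ = _⊕′_} h h-z h-⊕ (suc n) f =
  trans (h-⊕ _ _) (cong (h (f zero) ⊕′_) (sumFin-homo h h-z h-⊕ n (f ∘ suc)))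

Σℤ-zero : ∀ n {f : Fin n → ℤ} → (∀ i → f i ≡ + 0) → Σℤ n f ≡ + 0
Σℤ-zero zero    f≗0 = refl
Σℤ-zero (suc n) f≗0 = cong₂ _+_ (f≗0 zero) (Σℤ-zero n (f≗0 ∘ suc))

Σℤ-const : ∀ n → Σℤ n (λ _ → + 1) ≡ + n
Σℤ-const zero    = refl
Σℤ-const (suc n) = cong (_+_ (+ 1)) (Σℤ-const n)

Σℤ-distrib-+ : ∀ n (f g : Fin n → ℤ) → Σℤ n (λ i → f i + g i) ≡ Σℤ n f + Σℤ n g
Σℤ-distrib-+ zero    f g = refl
Σℤ-distrib-+ (suc n) f g =
  trans (cong (_+_ (f zero + g zero)) (Σℤ-distrib-+ n (f ∘ suc) (g ∘ suc)))
        (+-interchange (f zero) (g zero) _ _)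

Σℤ-distrib-- : ∀ n (f g : Fin n → ℤ) → Σℤ n (λ i → f i - g i) ≡ Σℤ n f - Σℤ n g
Σℤ-distrib-- n f g = trans (Σℤ-distrib-+ n f (-_ ∘ g))
  (cong (_+_ (Σℤ n f)) (sym (sumFin-homo -_ refl ℤP.neg-distrib-+ n g)))

Σℤ-*ˡ : ∀ n a (f : Fin n → ℤ) → Σℤ n (λ i → a * f i) ≡ a * Σℤ n f
Σℤ-*ˡ n a f = sym (sumFin-homo (a *_) (ℤP.*-zeroʳ a) (ℤP.*-distribˡ-+ a) n f)

Σℤ-*ʳ : ∀ n a (f : Fin n → ℤ) → Σℤ n (λ i → f i * a) ≡ Σℤ n f * a
Σℤ-*ʳ n a f = sym (sumFin-homo (_* a) refl (ℤP.*-distribʳ-+ a) n f)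

Σℤ-comm : ∀ m n (F : Fin m → Fin n → ℤ) →
          Σℤ m (λ i → Σℤ n (F i)) ≡ Σℤ n (λ j → Σℤ m (λ i → F i j))
Σℤ-comm zero    n F = sym (Σℤ-zero n (λ _ → refl))
Σℤ-comm (suc m) n F = trans (cong (_+_ (Σℤ n (F zero))) (Σℤ-comm m n (F ∘ suc)))
                            (sym (Σℤ-distrib-+ n (F zero) _))

Σℤ-single : ∀ n (f : Fin n → ℤ) j → (∀ i → i ≢ j → f i ≡ + 0) → Σℤ n f ≡ f j
Σℤ-single (suc n) f zero    f≗0 =
  trans (cong (_+_ (f zero)) (Σℤ-zero n (λ i → f≗0 (suc i) (λ ())))) (ℤP.+-identityʳ (f zero))
Σℤ-single (suc n) f (suc j) f≗0 =
  trans (cong (_+ Σℤ n (f ∘ suc)) (f≗0 zero (λ ()))) (trans (ℤP.+-identityˡ _)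
        (Σℤ-single n (f ∘ suc) j (λ i i≢j → f≗0 (suc i) (i≢j ∘ suc-injective))))

Σℤ-pair : ∀ n (f : Fin n → ℤ) {j j′} → j ≢ j′ →
          (∀ i → i ≢ j → i ≢ j′ → f i ≡ + 0) → Σℤ n f ≡ f j + f j′
Σℤ-pair (suc n) f {zero}  {zero}   j≢j′ f≗0 = contradiction refl j≢j′
Σℤ-pair (suc n) f {zero}  {suc j′} j≢j′ f≗0 = cong (_+_ (f zero))
  (Σℤ-single n (f ∘ suc) j′ (λ i i≢j′ → f≗0 (suc i) (λ ()) (i≢j′ ∘ suc-injective)))
Σℤ-pair (suc n) f {suc j} {zero}   j≢j′ f≗0 =
  trans (Σℤ-pair (suc n) f (j≢j′ ∘ sym) (λ i i≢j′ i≢j → f≗0 i i≢j i≢j′))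
        (ℤP.+-comm (f zero) (f (suc j)))
Σℤ-pair (suc n) f {suc j} {suc j′} j≢j′ f≗0 =
  trans (cong (_+ Σℤ n (f ∘ suc)) (f≗0 zero (λ ()) (λ ()))) (trans (ℤP.+-identityˡ _)
        (Σℤ-pair n (f ∘ suc) (j≢j′ ∘ cong suc)
          (λ i i≢j i≢j′ → f≗0 (suc i) (i≢j ∘ suc-injective) (i≢j′ ∘ suc-injective))))

count≡0⇒all-false : ∀ n (b : Fin n → Bool) →
                    Σℕ n (indicator ∘ b) ≡ 0 → ∀ i → b i ≡ false
count≡0⇒all-false (suc n) b count≡0 zero    with b zero
... | false = refl
count≡0⇒all-false (suc n) b count≡0 (suc i) =
  count≡0⇒all-false n (b ∘ suc) (ℕP.m+n≡0⇒n≡0 (indicator (b zero)) count≡0) i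

count≡1⇒unique : ∀ n (b : Fin n → Bool) → Σℕ n (indicator ∘ b) ≡ 1 →
                 ∃ λ j → b j ≡ true × (∀ i → i ≢ j → b i ≡ false)
count≡1⇒unique (suc n) b count≡1 with b zero in b₀
... | true  = zero , b₀ , λ
  { zero    0≢0 → contradiction refl 0≢0
  ; (suc i) _   → count≡0⇒all-false n (b ∘ suc) (ℕP.suc-injective count≡1) i }
... | false with count≡1⇒unique n (b ∘ suc) count≡1
...   | j , bⱼ , others = suc j , bⱼ , λ
  { zero    _   → b₀
  ; (suc i) i≢j → others i (i≢j ∘ cong suc) }

count≡2⇒pair : ∀ n (b : Fin n → Bool) → Σℕ n (indicator ∘ b) ≡ 2 →
               ∃₂ λ j j′ → j ≢ j′ × b j ≡ true × b j′ ≡ true ×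
                           (∀ i → i ≢ j → i ≢ j′ → b i ≡ false)
count≡2⇒pair (suc n) b count≡2 with b zero in b₀
... | true with count≡1⇒unique n (b ∘ suc) (ℕP.suc-injective count≡2)
...   | j , bⱼ , others = zero , suc j , (λ ()) , b₀ , bⱼ , λ
  { zero    0≢0 _    → contradiction refl 0≢0
  ; (suc i) _   i≢j′ → others i (i≢j′ ∘ cong suc) }
count≡2⇒pair (suc n) b count≡2 | false with count≡2⇒pair n (b ∘ suc) count≡2
...   | j , j′ , j≢j′ , bⱼ , bⱼ′ , others =
  suc j , suc j′ , j≢j′ ∘ suc-injective , bⱼ , bⱼ′ , λ
  { zero    _   _    → b₀
  ; (suc i) i≢j i≢j′ → others i (i≢j ∘ cong suc) (i≢j′ ∘ cong suc) }

IsSign : ℤ → Set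
IsSign x = x ≡ + 1 ⊎ x ≡ - + 1

sign-* : ∀ {x y} → IsSign x → IsSign y → IsSign (x * y)
sign-* (inj₁ refl) (inj₁ refl) = inj₁ refl
sign-* (inj₁ refl) (inj₂ refl) = inj₂ refl
sign-* (inj₂ refl) (inj₁ refl) = inj₂ refl
sign-* (inj₂ refl) (inj₂ refl) = inj₁ refl

∣sign∣≡1 : ∀ {x} → IsSign x → ∣ x ∣ ≡ 1
∣sign∣≡1 (inj₁ refl) = refl
∣sign∣≡1 (inj₂ refl) = refl

∣sign+sign∣≡1+product : ∀ {x y} → IsSign x → IsSign y → + ∣ x + y ∣ ≡ + 1 + x * y
∣sign+sign∣≡1+product (inj₁ refl) (inj₁ refl) = refl
∣sign+sign∣≡1+product (inj₁ refl) (inj₂ refl) = refl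
∣sign+sign∣≡1+product (inj₂ refl) (inj₁ refl) = refl
∣sign+sign∣≡1+product (inj₂ refl) (inj₂ refl) = refl

Σ∣sign∣ : ∀ n (x : Fin n → ℤ) → (∀ k → IsSign (x k)) → Σℤ n (λ k → + ∣ x k ∣) ≡ + n
Σ∣sign∣ n x signs = trans (sumFin-cong n (cong +_ ∘ ∣sign∣≡1 ∘ signs)) (Σℤ-const n)

Σ∣sign+sign∣ : ∀ n (x y : Fin n → ℤ) → (∀ k → IsSign (x k)) → (∀ k → IsSign (y k)) →
               Σℤ n (λ k → x k * y k) ≡ + 0 → Σℤ n (λ k → + ∣ x k + y k ∣) ≡ + n
Σ∣sign+sign∣ n x y x-signs y-signs x⊥y = begin
  Σℤ n (λ k → + ∣ x k + y k ∣)
    ≡⟨ sumFin-cong n (λ k → ∣sign+sign∣≡1+product (x-signs k) (y-signs k)) ⟩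
  Σℤ n (λ k → + 1 + x k * y k)
    ≡⟨ Σℤ-distrib-+ n _ _ ⟩
  Σℤ n (λ _ → + 1) + Σℤ n (λ k → x k * y k)
    ≡⟨ cong₂ _+_ (Σℤ-const n) x⊥y ⟩
  + n + + 0
    ≡⟨ ℤP.+-identityʳ (+ n) ⟩
  + n ∎

sgn : Bool → ℤ
sgn true  = + 1
sgn false = - + 1

-- The value on an edge of the ±1-circulation of a subgraph: s says whether the edge lies
-- in the subgraph, σ whether it is traversed from end₁ to end₂.
orientedIndicator : Bool → Bool → ℤ
orientedIndicator s σ = if s then sgn σ else + 0

orientedIndicator-sign : ∀ {s} σ → s ≡ true → IsSign (orientedIndicator s σ)
orientedIndicator-sign true  refl = inj₁ refl
orientedIndicator-sign false refl = inj₂ refl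

orientedIndicator-absent : ∀ {s} σ x → s ≡ false → orientedIndicator s σ * x ≡ + 0
orientedIndicator-absent σ x refl = refl

module _ {d} {H : Fin d → Fin d → ℤ} (isHadamard : IsHadamard d H) where

  hadamard-orthogonal : ∀ {j j′} → j ≢ j′ → Σℤ d (λ k → H j k * H j′ k) ≡ + 0
  hadamard-orthogonal {j} {j′} j≢j′ with j ≟ j′ | proj₂ isHadamard j j′
  ... | yes j≡j′ | _          = contradiction j≡j′ j≢j′
  ... | no _     | orthogonal = orthogonal

  Σ∣±row∣ : ∀ {a} j → IsSign a → Σℤ d (λ k → + ∣ a * H j k ∣) ≡ + d
  Σ∣±row∣ j a-sign = Σ∣sign∣ d _ (λ k → sign-* a-sign (proj₁ isHadamard j k))

  Σ∣±row±row∣ : ∀ {a b j j′} → j ≢ j′ → IsSign a → IsSign b →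
                Σℤ d (λ k → + ∣ a * H j k + b * H j′ k ∣) ≡ + d
  Σ∣±row±row∣ {a} {b} {j} {j′} j≢j′ a-sign b-sign =
    Σ∣sign+sign∣ d _ _ (λ k → sign-* a-sign (proj₁ isHadamard j k))
                       (λ k → sign-* b-sign (proj₁ isHadamard j′ k)) orthogonal
    where
    orthogonal : Σℤ d (λ k → a * H j k * (b * H j′ k)) ≡ + 0
    orthogonal = begin
      Σℤ d (λ k → a * H j k * (b * H j′ k))
        ≡⟨ sumFin-cong d (λ k → *-interchange a (H j k) b (H j′ k)) ⟩
      Σℤ d (λ k → a * b * (H j k * H j′ k))
        ≡⟨ Σℤ-*ˡ d (a * b) _ ⟩
      a * b * Σℤ d (λ k → H j k * H j′ k)
        ≡⟨ cong (a * b *_) (hadamard-orthogonal j≢j′) ⟩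
      a * b * + 0
        ≡⟨ ℤP.*-zeroʳ (a * b) ⟩
      + 0 ∎

  Σ∣row-combination∣ : (B σ : Fin d → Bool) →
    Σℕ d (indicator ∘ B) ≡ 1 ⊎ Σℕ d (indicator ∘ B) ≡ 2 →
    Σℤ d (λ k → + ∣ Σℤ d (λ i → orientedIndicator (B i) (σ i) * H i k) ∣) ≡ + d
  Σ∣row-combination∣ B σ (inj₁ count≡1) with count≡1⇒unique d B count≡1
  ... | j , Bⱼ , others = trans
    (sumFin-cong d (λ k → cong (+_ ∘ ∣_∣) (Σℤ-single d _ j
      (λ i i≢j → orientedIndicator-absent (σ i) (H i k) (others i i≢j)))))
    (Σ∣±row∣ j (orientedIndicator-sign (σ j) Bⱼ))
  Σ∣row-combination∣ B σ (inj₂ count≡2) with count≡2⇒pair d B count≡2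
  ... | j , j′ , j≢j′ , Bⱼ , Bⱼ′ , others = trans
    (sumFin-cong d (λ k → cong (+_ ∘ ∣_∣) (Σℤ-pair d _ j≢j′
      (λ i i≢j i≢j′ → orientedIndicator-absent (σ i) (H i k) (others i i≢j i≢j′)))))
    (Σ∣±row±row∣ j≢j′ (orientedIndicator-sign (σ j) Bⱼ) (orientedIndicator-sign (σ j′) Bⱼ′))

Pointwise-++⁻ : {A B : Set} {R : A → B → Set} (xs : List A) {ys : List A} {zs : List B} →
                Pointwise R (xs ++ ys) zs →
                ∃₂ λ zs₁ zs₂ → zs ≡ zs₁ ++ zs₂ × Pointwise R xs zs₁ × Pointwise R ys zs₂
Pointwise-++⁻ []       rs       = [] , _ , refl , [] , rs
Pointwise-++⁻ (x ∷ xs) (r ∷ rs) with Pointwise-++⁻ xs rs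
... | zs₁ , zs₂ , refl , rs₁ , rs₂ = _ ∷ zs₁ , zs₂ , refl , r ∷ rs₁ , rs₂

2∣m+m : ∀ m → 2 ∣ m ℕ.+ m
2∣m+m m = divides m (trans (cong (m ℕ.+_) (sym (ℕP.+-identityʳ m))) (ℕP.*-comm 2 m))

module EulerianOrientation {V : Set} (_≟ᵥ_ : DecidableEquality V) where

  -- (present?, tail, head): an absent edge contributes nothing but keeps its position.
  Edge : Set
  Edge = Bool × V × V

  orient : Bool → Edge → Edge
  orient true  x           = x
  orient false (a , u , w) = a , w , u

  Reorientation : Edge → Edge → Set
  Reorientation x y = ∃ λ b → y ≡ orient b x

  reorientation-trans : ∀ {x y z} → Reorientation x y → Reorientation y z → Reorientation x z
  reorientation-trans (true  , refl) y↝z            = y↝z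
  reorientation-trans (false , refl) (true  , refl) = false , refl
  reorientation-trans (false , refl) (false , refl) = true , refl

  deg : Edge → V → ℕ
  deg (a , u , w) v = if a then indicator ⌊ u ≟ᵥ v ⌋ ℕ.+ indicator ⌊ w ≟ᵥ v ⌋ else 0

  δ : V → V → ℤ
  δ u v = if ⌊ u ≟ᵥ v ⌋ then + 1 else + 0

  net : Edge → V → ℤ
  net (a , u , w) v = if a then δ w v - δ u v else + 0

  deg-orient : ∀ c x v → deg (orient c x) v ≡ deg x v
  deg-orient true  x                 v = refl
  deg-orient false (false , u , w)   v = refl
  deg-orient false (true  , u , w)   v = ℕP.+-comm (indicator ⌊ w ≟ᵥ v ⌋) _

  net-path : ∀ b u w y v →
    net (orient b (true , u , w)) v + net (orient b (true , w , y)) v ≡ net (orient b (true , u , y)) v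
  net-path true  u w y v =
    trans (ℤP.+-comm (δ w v - δ u v) _) (ℤP.+-minus-telescope (δ y v) (δ w v) (δ u v))
  net-path false u w y v = ℤP.+-minus-telescope (δ u v) (δ w v) (δ y v)

  net-orient : ∀ s σ u w v → net (orient σ (s , u , w)) v ≡
    (if ⌊ w ≟ᵥ v ⌋ then orientedIndicator s σ else + 0) -
    (if ⌊ u ≟ᵥ v ⌋ then orientedIndicator s σ else + 0)
  net-orient true  true  u w v = refl
  net-orient true  false u w v with ⌊ u ≟ᵥ v ⌋ | ⌊ w ≟ᵥ v ⌋
  ... | false | false = refl
  ... | false | true  = refl
  ... | true  | false = refl
  ... | true  | true  = refl
  net-orient false true  u w v = sym (cong₂ _-_ (if-eta ⌊ w ≟ᵥ v ⌋) (if-eta ⌊ u ≟ᵥ v ⌋))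
  net-orient false false u w v = sym (cong₂ _-_ (if-eta ⌊ w ≟ᵥ v ⌋) (if-eta ⌊ u ≟ᵥ v ⌋))

  Deg : List Edge → V → ℕ
  Deg []       v = 0
  Deg (x ∷ xs) v = deg x v ℕ.+ Deg xs v

  Net : List Edge → V → ℤ
  Net []       v = + 0
  Net (x ∷ xs) v = net x v + Net xs v

  Deg-middle : ∀ xs x ys v → Deg (xs ++ x ∷ ys) v ≡ deg x v ℕ.+ Deg (xs ++ ys) v
  Deg-middle []        x ys v = refl
  Deg-middle (x′ ∷ xs) x ys v =
    trans (cong (deg x′ v ℕ.+_) (Deg-middle xs x ys v))
          (ℕ-+-left-commute (deg x′ v) (deg x v) (Deg (xs ++ ys) v))

  Net-middle : ∀ xs x ys v → Net (xs ++ x ∷ ys) v ≡ net x v + Net (xs ++ ys) v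
  Net-middle []        x ys v = refl
  Net-middle (x′ ∷ xs) x ys v =
    trans (cong (_+_ (net x′ v)) (Net-middle xs x ys v))
          (+-left-commute (net x′ v) (net x v) (Net (xs ++ ys) v))

  Balanced : List Edge → Set
  Balanced xs = ∀ v → Net xs v ≡ + 0

  BalancedReorientation : List Edge → Set
  BalancedReorientation xs = ∃ λ ys → Pointwise Reorientation xs ys × Balanced ys

  IncidentAt : V → Edge → Set
  IncidentAt w x = ∃₂ λ c y → orient c x ≡ (true , w , y)

  IncidentSplit : V → List Edge → Set
  IncidentSplit w xs = ∃₂ λ pre post → ∃ λ x → xs ≡ pre ++ x ∷ post × IncidentAt w x

  incident? : ∀ w xs → IncidentSplit w xs ⊎ Deg xs w ≡ 0
  incident? w [] = inj₂ refl
  incident? w ((false , u , u′) ∷ xs) with incident? w xs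
  ... | inj₁ (pre , post , x , refl , x↦w) = inj₁ ((false , u , u′) ∷ pre , post , x , refl , x↦w)
  ... | inj₂ isolated                       = inj₂ isolated
  incident? w ((true , u , u′) ∷ xs) with u ≟ᵥ w | u′ ≟ᵥ w
  ... | yes refl | _        = inj₁ ([] , xs , _ , refl , true , u′ , refl)
  ... | no _     | yes refl = inj₁ ([] , xs , _ , refl , false , u , refl)
  ... | no _     | no _ with incident? w xs
  ...   | inj₁ (pre , post , x , refl , x↦w) = inj₁ ((true , u , u′) ∷ pre , post , x , refl , x↦w)
  ...   | inj₂ isolated                       = inj₂ isolated

  deg-link : ∀ {u w} → u ≢ w → deg (true , u , w) w ≡ 1
  deg-link {u} {w} u≢w with u ≟ᵥ w | w ≟ᵥ w
  ... | yes u≡w | _       = contradiction u≡w u≢w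
  ... | no _    | yes _   = refl
  ... | no _    | no w≢w = contradiction refl w≢w

  Deg-contract : ∀ u w y pre x post c → orient c x ≡ (true , w , y) → ∀ v →
    Deg ((true , u , w) ∷ pre ++ x ∷ post) v ≡
    (indicator ⌊ w ≟ᵥ v ⌋ ℕ.+ indicator ⌊ w ≟ᵥ v ⌋) ℕ.+ Deg ((true , u , y) ∷ pre ++ post) v
  Deg-contract u w y pre x post c x↦wy v = begin
    (ι u ℕ.+ ι w) ℕ.+ Deg (pre ++ x ∷ post) v ≡⟨ cong ((ι u ℕ.+ ι w) ℕ.+_) (Deg-middle pre x post v) ⟩
    (ι u ℕ.+ ι w) ℕ.+ (deg x v ℕ.+ D)         ≡⟨ cong (λ t → (ι u ℕ.+ ι w) ℕ.+ (t ℕ.+ D)) deg-x ⟩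
    (ι u ℕ.+ ι w) ℕ.+ ((ι w ℕ.+ ι y) ℕ.+ D)   ≡⟨ rearrange (ι u) (ι w) (ι y) D ⟩
    (ι w ℕ.+ ι w) ℕ.+ ((ι u ℕ.+ ι y) ℕ.+ D)   ∎
    where
    ι : V → ℕ
    ι u = indicator ⌊ u ≟ᵥ v ⌋
    D : ℕ
    D = Deg (pre ++ post) v
    deg-x : deg x v ≡ ι w ℕ.+ ι y
    deg-x = trans (sym (deg-orient c x v)) (cong (λ x′ → deg x′ v) x↦wy)
    rearrange : ∀ a b c D → (a ℕ.+ b) ℕ.+ ((b ℕ.+ c) ℕ.+ D) ≡ (b ℕ.+ b) ℕ.+ ((a ℕ.+ c) ℕ.+ D)
    rearrange = solve-∀

  contract : ∀ u w y pre x post c → orient c x ≡ (true , w , y) →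
    BalancedReorientation ((true , u , y) ∷ pre ++ post) →
    BalancedReorientation ((true , u , w) ∷ pre ++ x ∷ post)
  contract u w y pre x post c x↦wy (_ , (b , refl) ∷ rs , balanced) with Pointwise-++⁻ pre rs
  ... | zs₁ , zs₂ , refl , rs₁ , rs₂ =
    uw ∷ zs₁ ++ wy ∷ zs₂ ,
    (b , refl) ∷ ++⁺ rs₁ (reorientation-trans (c , sym x↦wy) (b , refl) ∷ rs₂) ,
    λ v → begin
      net uw v + Net (zs₁ ++ wy ∷ zs₂) v       ≡⟨ cong (_+_ (net uw v)) (Net-middle zs₁ wy zs₂ v) ⟩
      net uw v + (net wy v + Net (zs₁ ++ zs₂) v) ≡⟨ sym (ℤP.+-assoc (net uw v) _ _) ⟩
      net uw v + net wy v + Net (zs₁ ++ zs₂) v   ≡⟨ cong (_+ Net (zs₁ ++ zs₂) v) (net-path b u w y v) ⟩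
      net (orient b (true , u , y)) v + Net (zs₁ ++ zs₂) v ≡⟨ balanced v ⟩
      + 0                                        ∎
    where
    uw wy : Edge
    uw = orient b (true , u , w)
    wy = orient b (true , w , y)

  balancedReorientation : ∀ n xs → length xs ≡ n → (∀ v → 2 ∣ Deg xs v) → BalancedReorientation xs
  balancedReorientation _ [] _ _ = [] , [] , λ _ → refl
  balancedReorientation (suc n) ((false , u , w) ∷ xs) length≡ even
    with balancedReorientation n xs (ℕP.suc-injective length≡) even
  ... | ys , rs , balanced = (false , u , w) ∷ ys , (true , refl) ∷ rs ,
                             λ v → trans (ℤP.+-identityˡ (Net ys v)) (balanced v)
  balancedReorientation (suc n) ((true , u , w) ∷ xs) length≡ even with u ≟ᵥ w
  ... | yes refl with balancedReorientation n xs (ℕP.suc-injective length≡)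
                        (λ v → ∣m+n∣m⇒∣n (even v) (2∣m+m (indicator ⌊ u ≟ᵥ v ⌋)))
  ...   | ys , rs , balanced = (true , u , u) ∷ ys , (true , refl) ∷ rs ,
                                λ v → cong₂ _+_ (ℤP.+-inverseʳ (δ u v)) (balanced v)
  balancedReorientation (suc n) ((true , u , w) ∷ xs) length≡ even | no u≢w with incident? w xs
  ... | inj₂ isolated =
    contradiction (∣1⇒≡1 (subst (2 ∣_) (cong₂ ℕ._+_ (deg-link u≢w) isolated) (even w))) λ ()
  ... | inj₁ (pre , post , x , refl , c , y , x↦wy) =
    contract u w y pre x post c x↦wy (balancedReorientation n _
      (trans (sym (length-++-sucʳ pre x post)) (ℕP.suc-injective length≡))
      (λ v → ∣m+n∣m⇒∣n (subst (2 ∣_) (Deg-contract u w y pre x post c x↦wy v) (even v))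
                        (2∣m+m (indicator ⌊ w ≟ᵥ v ⌋))))

  Deg-tabulate : ∀ {n} (f : Fin n → Edge) v → Deg (tabulate f) v ≡ Σℕ n (λ i → deg (f i) v)
  Deg-tabulate {zero}  f v = refl
  Deg-tabulate {suc n} f v = cong (deg (f zero) v ℕ.+_) (Deg-tabulate (f ∘ suc) v)

  Net-tabulate : ∀ {n} (f : Fin n → Edge) v → Net (tabulate f) v ≡ Σℤ n (λ i → net (f i) v)
  Net-tabulate {zero}  f v = refl
  Net-tabulate {suc n} f v = cong (_+_ (net (f zero) v)) (Net-tabulate (f ∘ suc) v)

  reorientation-tabulate : ∀ {n} (f : Fin n → Edge) {ys} → Pointwise Reorientation (tabulate f) ys →
                           ∃ λ (σ : Fin n → Bool) → ys ≡ tabulate (λ i → orient (σ i) (f i))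
  reorientation-tabulate {zero}  f []               = (λ ()) , refl
  reorientation-tabulate {suc n} f ((b , refl) ∷ rs) with reorientation-tabulate (f ∘ suc) rs
  ... | σ , refl = (λ { zero → b ; (suc i) → σ i }) , refl

  balancedOrientation : ∀ {n} (f : Fin n → Edge) → (∀ v → 2 ∣ Σℕ n (λ i → deg (f i) v)) →
                        ∃ λ (σ : Fin n → Bool) → ∀ v → Σℤ n (λ i → net (orient (σ i) (f i)) v) ≡ + 0
  balancedOrientation f even
    with balancedReorientation _ (tabulate f) refl (λ v → subst (2 ∣_) (sym (Deg-tabulate f v)) (even v))
  ... | ys , rs , balanced with reorientation-tabulate f rs
  ...   | σ , refl = σ , λ v → trans (sym (Net-tabulate (λ i → orient (σ i) (f i)) v)) (balanced v)

Σℤ-masked-combination : ∀ n d (b : Fin n → Bool) (x : Fin d → Fin n → ℤ) (h : Fin d → ℤ) →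
  Σℤ n (λ e → if b e then Σℤ d (λ i → x i e * h i) else + 0) ≡
  Σℤ d (λ i → Σℤ n (λ e → if b e then x i e else + 0) * h i)
Σℤ-masked-combination n d b x h = begin
  Σℤ n (λ e → if b e then Σℤ d (λ i → x i e * h i) else + 0)
    ≡⟨ sumFin-cong n (λ e → mask-inside (b e)) ⟩
  Σℤ n (λ e → Σℤ d (λ i → (if b e then x i e else + 0) * h i))
    ≡⟨ Σℤ-comm n d _ ⟩
  Σℤ d (λ i → Σℤ n (λ e → (if b e then x i e else + 0) * h i))
    ≡⟨ sumFin-cong d (λ i → Σℤ-*ʳ n (h i) _) ⟩
  Σℤ d (λ i → Σℤ n (λ e → if b e then x i e else + 0) * h i) ∎
  where
  mask-inside : ∀ {e} c → (if c then Σℤ d (λ i → x i e * h i) else + 0) ≡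
                          Σℤ d (λ i → (if c then x i e else + 0) * h i)
  mask-inside true  = refl
  mask-inside false = sym (Σℤ-zero d (λ _ → refl))

fromℤ-+ : ∀ a b → fromℤ (a + b) ≡ fromℤ a ℚ.+ fromℤ b
fromℤ-+ a b = ℚP.toℚᵘ-injective
  (ℚᵘP.≃-trans (*≡* eq) (ℚᵘP.≃-sym (ℚP.toℚᵘ-homo-+ (fromℤ a) (fromℤ b))))
  where
  eq : (a + b) * + 1 ≡ (a * + 1 + b * + 1) * + 1
  eq = cong (_* + 1) (sym (cong₂ _+_ (ℤP.*-identityʳ a) (ℤP.*-identityʳ b)))

Σℚ-scaled-fromℤ : ∀ c n (f : Fin n → ℤ) → Σℚ n (λ i → c ℚ.* fromℤ (f i)) ≡ c ℚ.* fromℤ (Σℤ n f)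
Σℚ-scaled-fromℤ c n f = sym (sumFin-homo (λ z → c ℚ.* fromℤ z) (ℚP.*-zeroʳ c)
  (λ a b → trans (cong (c ℚ.*_) (fromℤ-+ a b)) (ℚP.*-distribˡ-+ c (fromℤ a) (fromℤ b))) n f)

Σℚ-masked-scaled-fromℤ : ∀ c n (b : Fin n → Bool) (f : Fin n → ℤ) →
  Σℚ n (λ i → if b i then c ℚ.* fromℤ (f i) else 0ℚ) ≡
  c ℚ.* fromℤ (Σℤ n (λ i → if b i then f i else + 0))
Σℚ-masked-scaled-fromℤ c n b f =
  trans (sumFin-cong n (λ i → mask-inside (b i))) (Σℚ-scaled-fromℤ c n _)
  where
  mask-inside : ∀ {i} b → (if b then c ℚ.* fromℤ (f i) else 0ℚ) ≡
                          c ℚ.* fromℤ (if b then f i else + 0)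
  mask-inside true  = refl
  mask-inside false = sym (ℚP.*-zeroʳ c)

norm₁-scaled-fromℤ : ∀ d c (z : Fin d → ℤ) →
  norm₁ d (λ k → c ℚ.* fromℤ (z k)) ≡ ℚ.∣ c ∣ ℚ.* fromℤ (Σℤ d (λ k → + ∣ z k ∣))
-- ℚ.∣ fromℤ z ∣ reduces to fromℤ (+ ∣ z ∣).
norm₁-scaled-fromℤ d c z = trans (sumFin-cong d (λ k → ℚP.∣p*q∣≡∣p∣*∣q∣ c (fromℤ (z k))))
                                 (Σℚ-scaled-fromℤ ℚ.∣ c ∣ d (λ k → + ∣ z k ∣))

module _ (G : Graph) where
  open EulerianOrientation (_≟_ {nV G})

  IsCirculation : (Fin (nE G) → ℤ) → Set
  IsCirculation x = ∀ v →
    Σℤ (nE G) (λ e → if ⌊ end₂ G e ≟ v ⌋ then x e else + 0) ≡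
    Σℤ (nE G) (λ e → if ⌊ end₁ G e ≟ v ⌋ then x e else + 0)

  cycle⇒circulation : (S : EdgeSet G) → IsCycle G S →
    ∃ λ (σ : Fin (nE G) → Bool) → IsCirculation (λ e → orientedIndicator (S e) (σ e))
  cycle⇒circulation S even with balancedOrientation (λ e → S e , end₁ G e , end₂ G e) even
  ... | σ , balanced = σ , λ v → ℤP.i-j≡0⇒i≡j _ _ (begin
    Σℤ (nE G) (inflow v) - Σℤ (nE G) (outflow v)
      ≡⟨ sym (Σℤ-distrib-- (nE G) (inflow v) (outflow v)) ⟩
    Σℤ (nE G) (λ e → inflow v e - outflow v e)
      ≡⟨ sumFin-cong (nE G) (λ e → sym (net-orient (S e) (σ e) (end₁ G e) (end₂ G e) v)) ⟩
    Σℤ (nE G) (λ e → net (orient (σ e) (S e , end₁ G e , end₂ G e)) v)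
      ≡⟨ balanced v ⟩
    + 0 ∎)
    where
    inflow outflow : Fin (nV G) → Fin (nE G) → ℤ
    inflow  v e = if ⌊ end₂ G e ≟ v ⌋ then orientedIndicator (S e) (σ e) else + 0
    outflow v e = if ⌊ end₁ G e ≟ v ⌋ then orientedIndicator (S e) (σ e) else + 0

  circulation-combination : ∀ {d} (x : Fin d → Fin (nE G) → ℤ) → (∀ i → IsCirculation (x i)) →
                            (h : Fin d → ℤ) → IsCirculation (λ e → Σℤ d (λ i → x i e * h i))
  circulation-combination {d} x circulations h v = begin
    Σℤ (nE G) (λ e → if ⌊ end₂ G e ≟ v ⌋ then Σℤ d (λ i → x i e * h i) else + 0)
      ≡⟨ Σℤ-masked-combination (nE G) d _ x h ⟩
    Σℤ d (λ i → Σℤ (nE G) (λ e → if ⌊ end₂ G e ≟ v ⌋ then x i e else + 0) * h i)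
      ≡⟨ sumFin-cong d (λ i → cong (_* h i) (circulations i v)) ⟩
    Σℤ d (λ i → Σℤ (nE G) (λ e → if ⌊ end₁ G e ≟ v ⌋ then x i e else + 0) * h i)
      ≡⟨ sym (Σℤ-masked-combination (nE G) d _ x h) ⟩
    Σℤ (nE G) (λ e → if ⌊ end₁ G e ≟ v ⌋ then Σℤ d (λ i → x i e * h i) else + 0)
      ∎

  circulation⇒flow : ∀ {d} (c : ℚ) (z : Fin (nE G) → Fin d → ℤ) →
                     (∀ k → IsCirculation (λ e → z e k)) →
                     IsFlow G d (λ _ → true) (λ e k → c ℚ.* fromℤ (z e k))
  circulation⇒flow c z circulations v k = begin
    Σℚ (nE G) (λ e → if ⌊ end₂ G e ≟ v ⌋ then c ℚ.* fromℤ (z e k) else 0ℚ)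
      ≡⟨ Σℚ-masked-scaled-fromℤ c (nE G) _ _ ⟩
    c ℚ.* fromℤ (Σℤ (nE G) (λ e → if ⌊ end₂ G e ≟ v ⌋ then z e k else + 0))
      ≡⟨ cong (λ t → c ℚ.* fromℤ t) (circulations k v) ⟩
    c ℚ.* fromℤ (Σℤ (nE G) (λ e → if ⌊ end₁ G e ≟ v ⌋ then z e k else + 0))
      ≡⟨ sym (Σℚ-masked-scaled-fromℤ c (nE G) _ _) ⟩
    Σℚ (nE G) (λ e → if ⌊ end₁ G e ≟ v ⌋ then c ℚ.* fromℤ (z e k) else 0ℚ)
      ∎

Σ∣z∣≡d⇒norm₁[z/d]≡1 : ∀ n (z : Fin (suc n) → ℤ) → Σℤ (suc n) (λ k → + ∣ z k ∣) ≡ + suc n →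
  norm₁ (suc n) (λ k → ℚ.1/ fromℤ (+ suc n) ℚ.* fromℤ (z k)) ≡ 1ℚ
-- The last step uses that ℚ.∣ c ∣ reduces to c, the reciprocal of a positive integer.
Σ∣z∣≡d⇒norm₁[z/d]≡1 n z Σ∣z∣≡d = begin
  norm₁ (suc n) (λ k → c ℚ.* fromℤ (z k))
    ≡⟨ norm₁-scaled-fromℤ (suc n) c z ⟩
  ℚ.∣ c ∣ ℚ.* fromℤ (Σℤ (suc n) (λ k → + ∣ z k ∣))
    ≡⟨ cong (λ t → ℚ.∣ c ∣ ℚ.* fromℤ t) Σ∣z∣≡d ⟩
  ℚ.∣ c ∣ ℚ.* fromℤ (+ suc n)
    ≡⟨ ℚP.*-inverseˡ (fromℤ (+ suc n)) ⟩
  1ℚ ∎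
  where
  c : ℚ
  c = ℚ.1/ fromℤ (+ suc n)

unit-norm-admissible : ∀ {q r} → q ≡ 1ℚ → 1ℚ ℚ.+ 1ℚ ℚ.< r → 1ℚ ℚ.≤ q × q ℚ.≤ r ℚ.- 1ℚ
unit-norm-admissible refl 2<r = ℚP.≤-refl , ℚP.<⇒≤ (ℚP.+-monoˡ-< (ℚ.- 1ℚ) 2<r)

indicator+n≡2⇒n≡1⊎n≡2 : ∀ b n → indicator b ℕ.+ n ≡ 2 → n ≡ 1 ⊎ n ≡ 2
indicator+n≡2⇒n≡1⊎n≡2 true  n eq = inj₁ (ℕP.suc-injective eq)
indicator+n≡2⇒n≡1⊎n≡2 false n eq = inj₂ eq

proposition18 : (G : Graph) (m : ℕ) → 2 ≤ m →
    HadamardExists (m ∸ 1) → HasCDC m G → Phi1IsTwo G (m ∸ 1)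
proposition18 G (suc (suc n)) (s≤s (s≤s z≤n)) (H , hadamard) (C , cycles , cover) r 2<r =
  (λ _ → true) , φ , circulation⇒flow G c z z-circulation ,
  λ e → unit-norm-admissible (norm₁-φ e) 2<r
  where
  orientation : ∀ i → ∃ λ σ → IsCirculation G (λ e → orientedIndicator (C (suc i) e) (σ e))
  orientation i = cycle⇒circulation G (C (suc i)) (cycles (suc i))
  z : Fin (nE G) → Fin (suc n) → ℤ
  z e k = Σℤ (suc n) (λ i → orientedIndicator (C (suc i) e) (proj₁ (orientation i) e) * H i k)
  z-circulation : ∀ k → IsCirculation G (λ e → z e k)
  z-circulation k = circulation-combination G _ (proj₂ ∘ orientation) (λ i → H i k)
  c : ℚ
  c = ℚ.1/ fromℤ (+ suc n)
  φ : Fin (nE G) → Vecℚ (suc n)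
  φ e k = c ℚ.* fromℤ (z e k)
  norm₁-φ : ∀ e → norm₁ (suc n) (φ e) ≡ 1ℚ
  norm₁-φ e = Σ∣z∣≡d⇒norm₁[z/d]≡1 n (z e)
    (Σ∣row-combination∣ hadamard (λ i → C (suc i) e) (λ i → proj₁ (orientation i) e)
      (indicator+n≡2⇒n≡1⊎n≡2 (C zero e) _ (cover e)))
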